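{- Let $G=\mathbb{Z}_{p_1^{r_1}}\times\cdots\times\mathbb{Z}_{p_k^{r_k}}$ be an abelian group with odd primes $p_1,\ldots,p_k$ (not necessarily distinct) and positive integers $r_i$. Then for every $I\in\mathcal{I}\cup\{G\}$, the structure class $X_I$ of $\mathsf{GEN}(G)$ has type $(1,0,0)$ if $\operatorname{spr}(G/I)=0$, $(1,2,1)$ if $\operatorname{spr}(G/I)=1$, $(1,2,0)$ if $\operatorname{spr}(G/I)=2$, and $(1,1,0)$ if $\operatorname{spr}(G/I)\ge 3$. Consequently the nim-number of $\mathsf{GEN}(G)$ is $0$ if $\operatorname{spr}(G)=0$, $2$ if $1\le\operatorname{spr}(G)\le 2$, and $1$ if $\operatorname{spr}(G)\ge 3$.
   Context: For a finite group $G$, the achievement game $\mathsf{GEN}(G)$ is the impartial game (normal play) with starting position $\emptyset$, positions $\emptyset$, the subsets $P\subseteq G$ with $\langle P\rangle\neq G$, and the subsets $P$ with $\langle P\rangle=G$ such that $\langle P\setminus\{s\}\rangle\neq G$ for some $s\in P$; a non-generating $P$ has options $\{P\cup\{g\}:g\in G\setminus P\}$ and a generating $P$ has none; $\operatorname{nim}(P)=\operatorname{mex}\{\operatorname{nim}(Q):Q\in\operatorname{Opt}(P)\}$ ($\operatorname{mex}$ = least nonnegative integer not in the set) and the nim-number of the game is $\operatorname{nim}(\emptyset)$. Let $\mathcal{M}$ be the set of maximal subgroups of $G$ and $\mathcal{I}=\{\bigcap\mathcal{N}:\emptyset\neq\mathcal{N}\subseteq\mathcal{M}\}$. For $I\in\mathcal{I}$,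 $X_I$ is the set of subsets $P\subseteq I$ not contained in any $J\in\mathcal{I}$ with $J\subsetneq I$; $X_G$ is the set of positions of $\mathsf{GEN}(G)$ that generate $G$. Write $\operatorname{pty}(n)=1$ if $n$ is odd and $0$ if $n$ is even. The type of $X_I$ is the triple $(\operatorname{pty}(|I|),a,b)$ where $a=\operatorname{nim}(P)$ for every position $P\in X_I$ with $|P|$ even and $b=\operatorname{nim}(Q)$ for every position $Q\in X_I$ with $|Q|$ odd (these are well defined); by convention the type of $X_G$ is $(\operatorname{pty}(|G|),0,0)$. For a finite abelian group $A$ with invariant factor decomposition $A\cong\mathbb{Z}_{\alpha_1}\times\cdots\times\mathbb{Z}_{\alpha_m}$ ($1\ne\alpha_1\mid\cdots\mid\alpha_m$), $\operatorname{spr}(A)=m$, and the trivial group has spread $0$. -}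

module Defs where

open import Data.Nat using (ℕ; zero; suc; _+_; _∸_; _^_; _≤_; _<_; _%_)
open import Data.Nat.Divisibility using (_∣_)
open import Data.Nat.DivMod using (m%n<n)
open import Data.Nat.Primality using (Prime)
open import Data.Fin using (Fin; toℕ; fromℕ<)
open import Data.Bool using (Bool; true; false; _∧_)
open import Data.Unit using (⊤; tt)
open import Data.Product using (Σ; ∃; _×_; _,_)
open import Data.Sum using (_⊎_)
open import Data.Empty using (⊥)
open import Data.List using (List; []; _∷_; map; concatMap; length; filterᵇ; foldr; allFin)
open import Data.List.Relation.Unary.All using (All)
open import Data.List.Relation.Unary.Linked using (Linked)
open import Data.List.Relation.Unary.Unique.Propositional using (Unique)
open import Data.List.Membership.Propositional using (_∈_; _∉_)
open import Relation.Nullary using (¬_)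
open import Relation.Binary.PropositionalEquality using (_≡_; _≢_)
open import Function.Bundles using (_⇔_)

-- The group  Z_{q_1} × ⋯ × Z_{q_k}  for a list of moduli qs.
-- Z_q is represented by Fin q with addition / negation modulo q.

El : List ℕ → Set
El []       = ⊤
El (q ∷ qs) = Fin q × El qs

addF : ∀ {q} → Fin q → Fin q → Fin q
addF {suc n} a b = fromℕ< (m%n<n (toℕ a + toℕ b) (suc n))

negF : ∀ {q} → Fin q → Fin q
negF {suc n} a = fromℕ< (m%n<n (suc n ∸ toℕ a) (suc n))

_⊕_ : ∀ {qs} → El qs → El qs → El qs
_⊕_ {[]}     _        _        = tt
_⊕_ {q ∷ qs} (a , x) (b , y) = addF a b , (x ⊕ y)

neg : ∀ {qs} → El qs → El qs
neg {[]}     _       = tt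
neg {q ∷ qs} (a , x) = negF a , neg x

IsZero : ∀ {qs} → El qs → Set
IsZero {[]}     _       = ⊤
IsZero {q ∷ qs} (a , x) = toℕ a ≡ 0 × IsZero x

allEl : (qs : List ℕ) → List (El qs)
allEl []       = tt ∷ []
allEl (q ∷ qs) = concatMap (λ a → map (λ x → (a , x)) (allEl qs)) (allFin q)

order : List ℕ → ℕ
order qs = length (allEl qs)

Subset : List ℕ → Set
Subset qs = El qs → Bool

_∈ˢ_ : ∀ {qs} → El qs → Subset qs → Set
x ∈ˢ H = H x ≡ true

_⊆ˢ_ : ∀ {qs} → Subset qs → Subset qs → Set
_⊆ˢ_ {qs} H K = (x : El qs) → x ∈ˢ H → x ∈ˢ K

_⊊ˢ_ : ∀ {qs} → Subset qs → Subset qs → Set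
_⊊ˢ_ {qs} H K = H ⊆ˢ K × Σ (El qs) (λ x → x ∈ˢ K × H x ≡ false)

card : ∀ {qs} → Subset qs → ℕ
card {qs} H = length (filterᵇ H (allEl qs))

IsSubgroup : (qs : List ℕ) → Subset qs → Set
IsSubgroup qs H =
  Σ (El qs) (λ x → x ∈ˢ H)
  × ((x y : El qs) → x ∈ˢ H → y ∈ˢ H → (x ⊕ y) ∈ˢ H)
  × ((x : El qs) → x ∈ˢ H → neg x ∈ˢ H)

IsMaximal : (qs : List ℕ) → Subset qs → Set
IsMaximal qs H =
  IsSubgroup qs H
  × Σ (El qs) (λ x → H x ≡ false)
  × ((K : Subset qs) → IsSubgroup qs K → H ⊆ˢ K →
       ((x : El qs) → K x ≡ H x) ⊎ ((x : El qs) → x ∈ˢ K))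

-- intersection of a (nonempty, in all uses) family of subsets
⋂ : ∀ {qs} → List (Subset qs) → Subset qs
⋂ 𝒩 x = foldr (λ H b → H x ∧ b) true 𝒩

InI : (qs : List ℕ) → Subset qs → Set
InI qs I = Σ (List (Subset qs)) (λ 𝒩 → 𝒩 ≢ [] × All (IsMaximal qs) 𝒩 × ((x : El qs) → ⋂ 𝒩 x ≡ I x))

Generates : (qs : List ℕ) → List (El qs) → Set
Generates qs P = (H : Subset qs) → IsSubgroup qs H → All (λ g → g ∈ˢ H) P → (x : El qs) → x ∈ˢ H

-- A position is a duplicate-free list P.
-- NimIs f P n  :  "nim(P) = n", defined by recursion on the number f of
-- elements of G not in P, spelling out  nim(P) = mex { nim(P ∪ {g}) : g ∉ P }
-- for non-generating P, and nim(P) = 0 (no options) for generating P.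

NimIs : (qs : List ℕ) → ℕ → List (El qs) → ℕ → Set
NimIs qs zero    P n = n ≡ 0
NimIs qs (suc f) P n =
  (Generates qs P × n ≡ 0)
  ⊎ (¬ Generates qs P
     × ((m : ℕ) → m < n → Σ (El qs) (λ g → g ∉ P × NimIs qs f (g ∷ P) m))
     × ((g : El qs) → g ∉ P → ¬ NimIs qs f (g ∷ P) n))

Nim : (qs : List ℕ) → List (El qs) → ℕ → Set
Nim qs P n = NimIs qs (order qs ∸ length P) P n

pty : ℕ → ℕ
pty n = n % 2

InX : (qs : List ℕ) → Subset qs → List (El qs) → Set
InX qs I P =
  Unique P × All (λ g → g ∈ˢ I) P
  × ((J : Subset qs) → InI qs J → J ⊊ˢ I → ¬ All (λ g → g ∈ˢ J) P)

Type : Set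
Type = ℕ × ℕ × ℕ

HasType : (qs : List ℕ) → Subset qs → Type → Set
HasType qs I (t , a , b) =
  pty (card I) ≡ t
  × ((P : List (El qs)) → InX qs I P → pty (length P) ≡ 0 → Nim qs P a)
  × ((P : List (El qs)) → InX qs I P → pty (length P) ≡ 1 → Nim qs P b)

HasTypeG : (qs : List ℕ) → Type → Set
HasTypeG qs (t , a , b) = pty (order qs) ≡ t × a ≡ 0 × b ≡ 0

-- Spread of a quotient G/I : spr(G/I) = m iff G/I ≅ Z_{α_1} × ⋯ × Z_{α_m}
-- with 1 ≠ α_1 ∣ ⋯ ∣ α_m.  The isomorphism G/I ≅ A is given (first
-- isomorphism theorem) as a surjective homomorphism G → A with kernel I.

IsHom : ∀ {qs as} → (El qs → El as) → Set
IsHom {qs} φ = (x y : El qs) → φ (x ⊕ y) ≡ φ x ⊕ φ y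

SpreadQuot : (qs : List ℕ) → Subset qs → ℕ → Set
SpreadQuot qs I m =
  Σ (List ℕ) λ αs →
    length αs ≡ m × All (λ α → 2 ≤ α) αs × Linked _∣_ αs
    × Σ (El qs → El αs) λ φ →
        IsHom φ
        × ((y : El αs) → Σ (El qs) (λ x → φ x ≡ y))
        × ((x : El qs) → (x ∈ˢ I) ⇔ IsZero (φ x))

trivialSub : ∀ {qs} → Subset qs
trivialSub {[]}     _       = true
trivialSub {q ∷ qs} (a , x) = isZ (toℕ a) ∧ trivialSub x
  where
  isZ : ℕ → Bool
  isZ zero    = true
  isZ (suc _) = false

Spread : (qs : List ℕ) → ℕ → Set
Spread qs m = SpreadQuot qs trivialSub m

moduli : List (ℕ × ℕ) → List ℕ
moduli = map (λ { (p , r) → p ^ r })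

OddPrimePower : ℕ × ℕ → Set
OddPrimePower (p , r) = Prime p × p % 2 ≡ 1 × 1 ≤ r

typeTable : ℕ → Type
typeTable 0             = (1 , 0 , 0)
typeTable 1             = (1 , 2 , 1)
typeTable 2             = (1 , 2 , 0)
typeTable (suc (suc (suc _))) = (1 , 1 , 0)

nimTable : ℕ → ℕ
nimTable 0 = 0
nimTable 1 = 2
nimTable 2 = 2
nimTable (suc (suc (suc _))) = 1

-- Call the deficiency of a position P the least number of elements that must be
-- added to P to generate G.  When G has no element of order 2, nim(P) depends only
-- on the deficiency k of P and the parity of |P|: every option of P has deficiency
-- k - 1 or k, some option has deficiency k - 1 (add the first element of a minimal
-- completion), and if |P| is even some option keeps deficiency k, because a
-- duplicate-free list containing 0 and closed under negation has odd length, so 0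
-- or some -x with x ∈ P lies in ⟨P⟩ but not in P.  Induction on the number of
-- elements outside P then gives the table deficiencyNim.
--
-- For P ∈ X_I the deficiency is m = spr(G/I).  Lifts of the standard basis of
-- G/I ≅ ℤ_α₁ × ⋯ × ℤ_αₘ generate G together with P: otherwise they lie in a
-- maximal subgroup M, and M ∩ I ∈ 𝓘 contains P, so I ⊆ M by the definition of
-- X_I, whence M = G.  Conversely, reduction modulo α₁ maps G onto (ℤ_α₁)^m and
-- kills P, and a group of exponent α₁ generated by s elements has at most α₁^s
-- elements.  Finally, subgroups of a group of odd order have odd order.

{-# OPTIONS --safe #-}
module Submission where

open import Defs

open import Level using (0ℓ)
open import Function using (_∘_)
open import Function.Bundles using (Equivalence)
open import Data.Empty using (⊥-elim)
open import Data.Unit using (tt)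
import Data.Unit.Properties as Unit
open import Data.Bool using (Bool; true; false; _∧_)
import Data.Bool.Properties as Bool
open import Data.Product using (Σ; ∃; ∃₂; _×_; _,_; proj₁; proj₂)
open import Data.Product.Properties using (≡-dec)
open import Data.Sum using (_⊎_; inj₁; inj₂)
open import Data.Nat using (ℕ; zero; suc; pred; _+_; _*_; _∸_; _^_; _≤_; _<_; _%_; _/_; z≤n; s≤s; z<s;
  NonZero; >-nonZero; parity)
open import Data.Nat.Properties using (+-comm; +-assoc; +-identityʳ; *-comm; *-identityʳ; m+[n∸m]≡n; m∸n≤m;
  m∸n≡0⇒m≤n; pred[m∸n]≡m∸[1+n]; suc-pred; suc-injective; 0≢1+n; ≤-reflexive; <⇒≤; <⇒≱; ≮⇒≥; <-≤-trans;
  m<1+n⇒m<n∨m≡n; <-cmp; ^-monoʳ-<)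
open import Data.Nat.DivMod using (%-distribˡ-+; %-distribˡ-*; m*n%n≡0; m%n%n≡m%n; m<n⇒m%n≡m; n%n≡0;
  m∣n⇒o%n%m≡o%m; m%n<n; m≡m%n+[m/n]*n)
open import Data.Nat.Divisibility using (_∣_; n∣m⇒m%n≡0; ∣m⇒∣m*n; ∣-trans; ∣-refl; ∣⇒≤)
open import Data.Nat.ListAction using (product)
open import Data.Nat.ListAction.Properties using (∈⇒∣product; product≢0)
open import Data.Parity.Base using (Parity; 0ℙ; 1ℙ; _⁻¹)
import Data.Parity.Properties as Parity
open import Data.Fin using (Fin; toℕ; fromℕ<)
import Data.Fin.Properties as Fin
open import Data.Fin.Properties using (toℕ-fromℕ<; toℕ-injective; toℕ<n)
open import Data.List using (List; []; _∷_; length; map; _++_; filter; filterᵇ; concatMap; cartesianProduct; allFin;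
  replicate)
open import Data.List.Properties using (length-++; length-map; length-tabulate; ++-identityʳ; filter-all;
  filter-accept; filter-reject; filter-notAll)
open import Data.List.Relation.Unary.All using (All; []; _∷_)
import Data.List.Relation.Unary.All as All
import Data.List.Relation.Unary.All.Properties as All
open import Data.List.Relation.Unary.Any using (any?; here; there)
import Data.List.Relation.Unary.Any as Any
open import Data.List.Relation.Unary.AllPairs using ([]; _∷_)
open import Data.List.Relation.Unary.Linked using (Linked)
open import Data.List.Relation.Unary.Linked.Properties using (Linked⇒All)
open import Data.List.Relation.Unary.Unique.Propositional using (Unique)
import Data.List.Relation.Unary.Unique.Propositional.Properties as Unique
open import Data.List.Membership.Propositional using (_∈_; _∉_; find; lose)
open import Data.List.Membership.Propositional.Properties using (∈-allFin; ∈-map⁺; ∈-map⁻;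
  ∈-cartesianProduct⁺; ∈-cartesianProduct⁻; ∈-++⁻; ∈-++⁺ˡ; ∈-++⁺ʳ; ∈-filter⁺; ∈-filter⁻)
open import Data.List.Membership.DecPropositional using () renaming (_∈?_ to ∈?[_])
open import Data.List.Relation.Binary.Subset.Propositional using (_⊆_)
open import Data.List.Relation.Binary.Subset.Propositional.Properties using (xs⊆x∷xs)
open import Data.List.Relation.Binary.Permutation.Propositional using (_↭_; ↭-sym)
open import Data.List.Relation.Binary.Permutation.Propositional.Properties using (∈-resp-↭; shift)
open import Algebra.Bundles using (AbelianGroup)
open import Algebra.Core using (Op₁; Op₂)
open import Algebra.Definitions using (Commutative; Associative; LeftIdentity; RightInverse)
open import Algebra.Structures using (IsAbelianGroup)
open import Algebra.Consequences.Propositional using (comm∧idˡ⇒id; comm∧invʳ⇒inv)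
import Algebra.Properties.AbelianGroup as AbelianGroupProperties
import Algebra.Properties.CommutativeSemigroup as CommutativeSemigroupProperties
import Algebra.Properties.Monoid.Mult as Mult
open import Relation.Binary using (DecidableEquality; tri<; tri≈; tri>)
open import Relation.Binary.PropositionalEquality hiding (J)
open import Relation.Binary.PropositionalEquality.Algebra using (isMagma)
open import Relation.Nullary using (Dec; yes; no; ¬_; ¬?; does; _×-dec_)
open import Relation.Nullary.Decidable using (dec-true; decidable-stable; T?)
import Relation.Nullary.Decidable as Dec
open import Relation.Unary using (Decidable)

-- Duplicate-free lists

module _ {A : Set} (_≟_ : DecidableEquality A) where

  _∖_ : List A → A → List A
  xs ∖ x = filter (¬? ∘ (_≟ x)) xs

  ∈-∖⁺ : ∀ {x y xs} → y ∈ xs → y ≢ x → y ∈ xs ∖ x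
  ∈-∖⁺ = ∈-filter⁺ (¬? ∘ (_≟ _))

  ∈-∖⁻ : ∀ {x y} xs → y ∈ xs ∖ x → y ∈ xs × y ≢ x
  ∈-∖⁻ xs = ∈-filter⁻ (¬? ∘ (_≟ _)) {xs = xs}

  ∖-unique : ∀ {x xs} → Unique xs → Unique (xs ∖ x)
  ∖-unique = Unique.filter⁺ (¬? ∘ (_≟ _))

  length-∖ : ∀ {x xs} → Unique xs → x ∈ xs → length xs ≡ suc (length (xs ∖ x))
  length-∖ {x} {_ ∷ xs} (x∉xs ∷ _) (here refl) = cong suc (begin
    length xs              ≡⟨ cong length (filter-all (¬? ∘ (_≟ x)) (All.map (λ x≢y y≡x → x≢y (sym y≡x)) x∉xs)) ⟨
    length (xs ∖ x)        ≡⟨ cong length (filter-reject (¬? ∘ (_≟ x)) (λ x≢x → x≢x refl)) ⟨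
    length ((x ∷ xs) ∖ x)  ∎)
    where open ≡-Reasoning
  length-∖ {x} {y ∷ xs} (y∉xs ∷ u) (there x∈xs) = begin
    suc (length xs)              ≡⟨ cong suc (length-∖ u x∈xs) ⟩
    suc (suc (length (xs ∖ x)))  ≡⟨ cong (suc ∘ length) (filter-accept (¬? ∘ (_≟ x)) (All.lookup y∉xs x∈xs)) ⟨
    suc (length ((y ∷ xs) ∖ x))  ∎
    where open ≡-Reasoning

  Unique⇒length≤ : ∀ {xs ys} → Unique xs → xs ⊆ ys → length xs ≤ length ys
  Unique⇒length≤ {[]}     _             _  = z≤n
  Unique⇒length≤ {x ∷ xs} {ys} (x∉xs ∷ u) xs⊆ys = <-≤-trans
    (s≤s (Unique⇒length≤ u xs⊆ys∖x))
    (filter-notAll (¬? ∘ (_≟ x)) ys (Any.map (λ x≡y x≢y → x≢y (sym x≡y)) (xs⊆ys (here refl))))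
    where
    xs⊆ys∖x : xs ⊆ ys ∖ x
    xs⊆ys∖x y∈xs = ∈-∖⁺ (xs⊆ys (there y∈xs)) (λ y≡x → All.lookup x∉xs y∈xs (sym y≡x))

  module _ (f : A → A) (z : A) (f-involutive : ∀ x → f (f x) ≡ x) (f-z : f z ≡ z)
           (fixed⇒z : ∀ x → f x ≡ x → x ≡ z) where

    closed-odd : ∀ n {xs} → length xs ≡ n → Unique xs → z ∈ xs →
                 (∀ {y} → y ∈ xs → f y ∈ xs) → parity n ≡ 1ℙ
    closed-odd zero          {[]} refl _ () _
    closed-odd (suc zero)    _    _ _ _ = refl
    closed-odd (suc (suc n)) {xs} len u z∈xs closed with any? (λ y → ¬? (y ≟ z)) xs
    ... | no ¬∃y≢z with s≤s () ← subst (_≤ 1) len (Unique⇒length≤ {ys = z ∷ []} u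
            (λ y∈xs → here (decidable-stable (_ ≟ z) (All.lookup (All.¬Any⇒All¬ xs ¬∃y≢z) y∈xs))))
    ... | yes ∃y≢z =
      closed-odd n (suc-injective (suc-injective (trans (sym length-xs) len))) u″ z∈xs″ closed″
      where
      x = proj₁ (find ∃y≢z)
      x∈xs = proj₁ (proj₂ (find ∃y≢z))
      x≢z = proj₂ (proj₂ (find ∃y≢z))
      f-injective : ∀ {a b} → f a ≡ f b → a ≡ b
      f-injective {a} {b} eq = trans (sym (f-involutive a)) (trans (cong f eq) (f-involutive b))
      fx∈xs′ : f x ∈ xs ∖ x
      fx∈xs′ = ∈-∖⁺ (closed x∈xs) (λ fx≡x → x≢z (fixed⇒z x fx≡x))
      xs″ = (xs ∖ x) ∖ f x
      u″ : Unique xs″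
      u″ = ∖-unique (∖-unique u)
      length-xs : length xs ≡ suc (suc (length xs″))
      length-xs = trans (length-∖ u x∈xs) (cong suc (length-∖ (∖-unique u) fx∈xs′))
      z∈xs″ : z ∈ xs″
      z∈xs″ = ∈-∖⁺ (∈-∖⁺ z∈xs (λ z≡x → x≢z (sym z≡x)))
                    (λ z≡fx → x≢z (f-injective (trans (sym z≡fx) (sym f-z))))
      closed″ : ∀ {y} → y ∈ xs″ → f y ∈ xs″
      closed″ {y} y∈xs″ with ∈-∖⁻ (xs ∖ x) y∈xs″
      ... | y∈xs′ , y≢fx with ∈-∖⁻ xs y∈xs′
      ...   | y∈xs , y≢x = ∈-∖⁺ (∈-∖⁺ (closed y∈xs) fy≢x) (λ fy≡fx → y≢x (f-injective fy≡fx))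
        where
        fy≢x : f y ≢ x
        fy≢x fy≡x = y≢fx (f-injective (trans fy≡x (sym (f-involutive x))))

-- The groups ℤ_q₁ × ⋯ × ℤ_qₖ

isAbelianGroup′ : {A : Set} {_∙_ : Op₂ A} {ε : A} {_⁻¹ : Op₁ A} →
  Commutative _≡_ _∙_ → Associative _≡_ _∙_ → LeftIdentity _≡_ ε _∙_ →
  RightInverse _≡_ ε _⁻¹ _∙_ → IsAbelianGroup _≡_ _∙_ ε _⁻¹
isAbelianGroup′ {_∙_ = _∙_} {_⁻¹ = _⁻¹} comm assoc idˡ invʳ = record
  { isGroup = record
    { isMonoid = record
      { isSemigroup = record { isMagma = isMagma _∙_ ; assoc = assoc }
      ; identity = comm∧idˡ⇒id comm idˡ }
    ; inverse = comm∧invʳ⇒inv comm invʳ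
    ; ⁻¹-cong = cong _⁻¹ }
  ; comm = comm }

[m%n+k]%n≡[m+k]%n : ∀ m k n .{{_ : NonZero n}} → (m % n + k) % n ≡ (m + k) % n
[m%n+k]%n≡[m+k]%n m k n = begin
  (m % n + k) % n          ≡⟨ %-distribˡ-+ (m % n) k n ⟩
  (m % n % n + k % n) % n  ≡⟨ cong (λ t → (t + k % n) % n) (m%n%n≡m%n m n) ⟩
  (m % n + k % n) % n      ≡⟨ %-distribˡ-+ m k n ⟨
  (m + k) % n              ∎
  where open ≡-Reasoning

[m+k%n]%n≡[m+k]%n : ∀ m k n .{{_ : NonZero n}} → (m + k % n) % n ≡ (m + k) % n
[m+k%n]%n≡[m+k]%n m k n = begin
  (m + k % n) % n  ≡⟨ cong (_% n) (+-comm m (k % n)) ⟩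
  (k % n + m) % n  ≡⟨ [m%n+k]%n≡[m+k]%n k m n ⟩
  (k + m) % n      ≡⟨ cong (_% n) (+-comm k m) ⟩
  (m + k) % n      ∎
  where open ≡-Reasoning

module _ {n : ℕ} where

  toℕ-addF : (a b : Fin (suc n)) → toℕ (addF a b) ≡ (toℕ a + toℕ b) % suc n
  toℕ-addF a b = toℕ-fromℕ< _

  toℕ-negF : (a : Fin (suc n)) → toℕ (negF a) ≡ (suc n ∸ toℕ a) % suc n
  toℕ-negF a = toℕ-fromℕ< _

  addF-comm : Commutative _≡_ (addF {suc n})
  addF-comm a b = toℕ-injective (begin
    toℕ (addF a b)                ≡⟨ toℕ-addF a b ⟩
    (toℕ a + toℕ b) % suc n       ≡⟨ cong (_% suc n) (+-comm (toℕ a) (toℕ b)) ⟩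
    (toℕ b + toℕ a) % suc n       ≡⟨ toℕ-addF b a ⟨
    toℕ (addF b a)                ∎)
    where open ≡-Reasoning

  addF-assoc : Associative _≡_ (addF {suc n})
  addF-assoc a b c = toℕ-injective (begin
    toℕ (addF (addF a b) c)                    ≡⟨ toℕ-addF (addF a b) c ⟩
    (toℕ (addF a b) + toℕ c) % suc n           ≡⟨ cong (λ t → (t + toℕ c) % suc n) (toℕ-addF a b) ⟩
    ((toℕ a + toℕ b) % suc n + toℕ c) % suc n  ≡⟨ [m%n+k]%n≡[m+k]%n (toℕ a + toℕ b) (toℕ c) (suc n) ⟩
    (toℕ a + toℕ b + toℕ c) % suc n            ≡⟨ cong (_% suc n) (+-assoc (toℕ a) (toℕ b) (toℕ c)) ⟩
    (toℕ a + (toℕ b + toℕ c)) % suc n          ≡⟨ [m+k%n]%n≡[m+k]%n (toℕ a) (toℕ b + toℕ c) (suc n) ⟨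
    (toℕ a + (toℕ b + toℕ c) % suc n) % suc n  ≡⟨ cong (λ t → (toℕ a + t) % suc n) (toℕ-addF b c) ⟨
    (toℕ a + toℕ (addF b c)) % suc n           ≡⟨ toℕ-addF a (addF b c) ⟨
    toℕ (addF a (addF b c))                    ∎)
    where open ≡-Reasoning

  addF-identityˡ : LeftIdentity _≡_ Fin.zero (addF {suc n})
  addF-identityˡ a = toℕ-injective (trans (toℕ-addF Fin.zero a) (m<n⇒m%n≡m (toℕ<n a)))

  addF-inverseʳ : RightInverse _≡_ Fin.zero negF (addF {suc n})
  addF-inverseʳ a = toℕ-injective (begin
    toℕ (addF a (negF a))                    ≡⟨ toℕ-addF a (negF a) ⟩
    (toℕ a + toℕ (negF a)) % suc n           ≡⟨ cong (λ t → (toℕ a + t) % suc n) (toℕ-negF a) ⟩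
    (toℕ a + (suc n ∸ toℕ a) % suc n) % suc n ≡⟨ [m+k%n]%n≡[m+k]%n (toℕ a) _ (suc n) ⟩
    (toℕ a + (suc n ∸ toℕ a)) % suc n        ≡⟨ cong (_% suc n) (m+[n∸m]≡n (<⇒≤ (toℕ<n a))) ⟩
    suc n % suc n                            ≡⟨ n%n≡0 (suc n) ⟩
    0                                        ∎)
    where open ≡-Reasoning

  negF-zero : negF {suc n} Fin.zero ≡ Fin.zero
  negF-zero = toℕ-injective (trans (toℕ-negF Fin.zero) (n%n≡0 (suc n)))

  addF-abelianGroup : AbelianGroup 0ℓ 0ℓ
  addF-abelianGroup = record
    { isAbelianGroup = isAbelianGroup′ addF-comm addF-assoc addF-identityˡ addF-inverseʳ }

0ᴱ : ∀ {qs} → All (0 <_) qs → El qs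
0ᴱ []              = tt
0ᴱ (s≤s z≤n ∷ pos) = Fin.zero , 0ᴱ pos

⊕-comm : ∀ {qs} → Commutative _≡_ (_⊕_ {qs})
⊕-comm {[]}         x       y       = refl
⊕-comm {zero ∷ qs}  (() , _)
⊕-comm {suc n ∷ qs} (a , x) (b , y) = cong₂ _,_ (addF-comm a b) (⊕-comm x y)

⊕-assoc : ∀ {qs} → Associative _≡_ (_⊕_ {qs})
⊕-assoc {[]}         x       y       z       = refl
⊕-assoc {zero ∷ qs}  (() , _)
⊕-assoc {suc n ∷ qs} (a , x) (b , y) (c , z) = cong₂ _,_ (addF-assoc a b c) (⊕-assoc x y z)

⊕-identityˡ : ∀ {qs} (pos : All (0 <_) qs) → LeftIdentity _≡_ (0ᴱ pos) _⊕_
⊕-identityˡ []              x       = refl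
⊕-identityˡ (s≤s z≤n ∷ pos) (a , x) = cong₂ _,_ (addF-identityˡ a) (⊕-identityˡ pos x)

⊕-inverseʳ : ∀ {qs} (pos : All (0 <_) qs) → RightInverse _≡_ (0ᴱ pos) neg _⊕_
⊕-inverseʳ []              x       = refl
⊕-inverseʳ (s≤s z≤n ∷ pos) (a , x) = cong₂ _,_ (addF-inverseʳ a) (⊕-inverseʳ pos x)

El-abelianGroup : ∀ {qs} → All (0 <_) qs → AbelianGroup 0ℓ 0ℓ
El-abelianGroup pos = record
  { isAbelianGroup = isAbelianGroup′ ⊕-comm ⊕-assoc (⊕-identityˡ pos) (⊕-inverseʳ pos) }

_≟ᴱ_ : ∀ {qs} → DecidableEquality (El qs)
_≟ᴱ_ {[]}     = Unit._≟_
_≟ᴱ_ {q ∷ qs} = ≡-dec Fin._≟_ _≟ᴱ_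

IsZero⇒≡0ᴱ : ∀ {qs} (pos : All (0 <_) qs) {x : El qs} → IsZero x → x ≡ 0ᴱ pos
IsZero⇒≡0ᴱ []              {tt}    _          = refl
IsZero⇒≡0ᴱ (s≤s z≤n ∷ pos) {a , x} (a≡0 , x≡0) =
  cong₂ _,_ (toℕ-injective a≡0) (IsZero⇒≡0ᴱ pos x≡0)

≡0ᴱ⇒IsZero : ∀ {qs} (pos : All (0 <_) qs) {x : El qs} → x ≡ 0ᴱ pos → IsZero x
≡0ᴱ⇒IsZero []              refl = tt
≡0ᴱ⇒IsZero (s≤s z≤n ∷ pos) refl = refl , ≡0ᴱ⇒IsZero pos refl

trivialSub⇒≡0ᴱ : ∀ {qs} (pos : All (0 <_) qs) {x : El qs} → x ∈ˢ trivialSub → x ≡ 0ᴱ pos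
trivialSub⇒≡0ᴱ []              {tt}             _ = refl
trivialSub⇒≡0ᴱ (s≤s z≤n ∷ pos) {Fin.zero , x}  x∈ = cong (Fin.zero ,_) (trivialSub⇒≡0ᴱ pos x∈)

allEl-cartesianProduct : ∀ q qs → allEl (q ∷ qs) ≡ cartesianProduct (allFin q) (allEl qs)
allEl-cartesianProduct q qs = go (allFin q)
  where
  go : ∀ as → concatMap (λ a → map (a ,_) (allEl qs)) as ≡ cartesianProduct as (allEl qs)
  go []       = refl
  go (a ∷ as) = cong (map (a ,_) (allEl qs) ++_) (go as)

∈-allEl : ∀ {qs} (x : El qs) → x ∈ allEl qs
∈-allEl {[]}     tt      = here refl
∈-allEl {q ∷ qs} (a , x) = subst ((a , x) ∈_) (sym (allEl-cartesianProduct q qs))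
  (∈-cartesianProduct⁺ (∈-allFin a) (∈-allEl x))

allEl-unique : ∀ qs → Unique (allEl qs)
allEl-unique []       = [] ∷ []
allEl-unique (q ∷ qs) = subst Unique (sym (allEl-cartesianProduct q qs))
  (Unique.cartesianProduct⁺ (Unique.allFin⁺ q) (allEl-unique qs))

length-allFin : ∀ n → length (allFin n) ≡ n
length-allFin n = length-tabulate {n = n} (λ i → i)

length-cartesianProduct : {A B : Set} (xs : List A) (ys : List B) →
  length (cartesianProduct xs ys) ≡ length xs * length ys
length-cartesianProduct []       ys = refl
length-cartesianProduct (x ∷ xs) ys = trans (length-++ (map (x ,_) ys))
  (cong₂ _+_ (length-map (x ,_) ys) (length-cartesianProduct xs ys))

order≡product : ∀ qs → order qs ≡ product qs
order≡product []       = refl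
order≡product (q ∷ qs) = begin
  length (allEl (q ∷ qs))                          ≡⟨ cong length (allEl-cartesianProduct q qs) ⟩
  length (cartesianProduct (allFin q) (allEl qs))  ≡⟨ length-cartesianProduct (allFin q) (allEl qs) ⟩
  length (allFin q) * order qs                     ≡⟨ cong₂ _*_ (length-allFin q) (order≡product qs) ⟩
  q * product qs                                   ∎
  where open ≡-Reasoning

product-replicate : ∀ m a → product (replicate m a) ≡ a ^ m
product-replicate zero    a = refl
product-replicate (suc m) a = cong (a *_) (product-replicate m a)

infixr 25 _·ᶠ_
_·ᶠ_ : ∀ {n} → ℕ → Fin (suc n) → Fin (suc n)
_·ᶠ_ {n} = Mult._×_ (AbelianGroup.monoid (addF-abelianGroup {n}))

module _ {n : ℕ} where

  toℕ-·ᶠ : ∀ c (a : Fin (suc n)) → toℕ (c ·ᶠ a) ≡ (c * toℕ a) % suc n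
  toℕ-·ᶠ zero    a = refl
  toℕ-·ᶠ (suc c) a = begin
    toℕ (addF a (c ·ᶠ a))                  ≡⟨ toℕ-addF a (c ·ᶠ a) ⟩
    (toℕ a + toℕ (c ·ᶠ a)) % suc n         ≡⟨ cong (λ t → (toℕ a + t) % suc n) (toℕ-·ᶠ c a) ⟩
    (toℕ a + (c * toℕ a) % suc n) % suc n  ≡⟨ [m+k%n]%n≡[m+k]%n (toℕ a) (c * toℕ a) (suc n) ⟩
    (toℕ a + c * toℕ a) % suc n            ∎
    where open ≡-Reasoning

  ·ᶠ-exponent : ∀ {e} → suc n ∣ e → (a : Fin (suc n)) → e ·ᶠ a ≡ Fin.zero
  ·ᶠ-exponent {e} n∣e a =
    toℕ-injective (trans (toℕ-·ᶠ e a) (n∣m⇒m%n≡0 (e * toℕ a) (suc n) (∣m⇒∣m*n (toℕ a) n∣e)))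

module ElGroup {qs : List ℕ} (pos : All (0 <_) qs) where

  abelianGroup : AbelianGroup 0ℓ 0ℓ
  abelianGroup = El-abelianGroup pos

  open AbelianGroup abelianGroup public using (identityˡ; identityʳ; inverseˡ; inverseʳ; assoc)
  open AbelianGroupProperties abelianGroup public
  open CommutativeSemigroupProperties (AbelianGroup.commutativeSemigroup abelianGroup) public
    using (interchange)
  open Mult (AbelianGroup.monoid abelianGroup) public
    using () renaming (_×_ to infixr 25 _·_; ×-homo-+ to ·-homo-+; ×-assocˡ to ·-assocˡ)

  ε : El qs
  ε = 0ᴱ pos

  ·-ε : ∀ k → k · ε ≡ ε
  ·-ε zero    = refl
  ·-ε (suc k) = trans (identityˡ (k · ε)) (·-ε k)

  [x⊕-y]⊕y≡x : ∀ x y → (x ⊕ neg y) ⊕ y ≡ x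
  [x⊕-y]⊕y≡x x y = trans (assoc x (neg y) y) (trans (cong (x ⊕_) (inverseˡ y)) (identityʳ x))

·-cons : ∀ {n qs} (pos : All (0 <_) qs) c (a : Fin (suc n)) (x : El qs) →
  ElGroup._·_ (s≤s z≤n ∷ pos) c (a , x) ≡ (c ·ᶠ a , ElGroup._·_ pos c x)
·-cons pos zero    a x = refl
·-cons pos (suc c) a x = cong ((a , x) ⊕_) (·-cons pos c a x)

·-exponent : ∀ {qs} (pos : All (0 <_) qs) {e} → All (_∣ e) qs → ∀ x → ElGroup._·_ pos e x ≡ 0ᴱ pos
·-exponent []              _         tt      = refl
·-exponent (s≤s z≤n ∷ pos) {e} (q∣e ∷ ∣e) (a , x) =
  trans (·-cons pos e a x) (cong₂ _,_ (·ᶠ-exponent q∣e a) (·-exponent pos ∣e x))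

-- Subgroups

module _ {qs : List ℕ} where

  ⟦_⟧ : {P : El qs → Set} → Decidable P → Subset qs
  ⟦ P? ⟧ x = does (P? x)

  ∈⟦⟧⁺ : {P : El qs → Set} (P? : Decidable P) {x : El qs} → P x → x ∈ˢ ⟦ P? ⟧
  ∈⟦⟧⁺ P? = dec-true (P? _)

  ∈⟦⟧⁻ : {P : El qs → Set} (P? : Decidable P) {x : El qs} → x ∈ˢ ⟦ P? ⟧ → P x
  ∈⟦⟧⁻ P? {x} x∈ with P? x
  ... | yes px = px

  searchᴱ : {P : El qs → Set} → Decidable P → Dec (∃ P)
  searchᴱ P? = Dec.map′ (λ ∃x → let (x , _ , px) = find ∃x in x , px)
                        (λ (x , px) → lose (∈-allEl x) px)
                        (any? P? (allEl qs))

  _∈ˢ?_ : (x : El qs) (H : Subset qs) → Dec (x ∈ˢ H)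
  x ∈ˢ? H = H x Bool.≟ true

module Subgroups {qs : List ℕ} (pos : All (0 <_) qs) where

  open ElGroup pos

  ⊕∈ : ∀ {H x y} → IsSubgroup qs H → x ∈ˢ H → y ∈ˢ H → (x ⊕ y) ∈ˢ H
  ⊕∈ (_ , ⊕-closed , _) = ⊕-closed _ _

  neg∈ : ∀ {H x} → IsSubgroup qs H → x ∈ˢ H → neg x ∈ˢ H
  neg∈ (_ , _ , neg-closed) = neg-closed _

  ε∈ : ∀ {H} → IsSubgroup qs H → ε ∈ˢ H
  ε∈ {H} H≤@((y , y∈H) , _) = subst (_∈ˢ H) (inverseʳ y) (⊕∈ H≤ y∈H (neg∈ H≤ y∈H))

  ·∈ : ∀ {H x} → IsSubgroup qs H → x ∈ˢ H → ∀ c → (c · x) ∈ˢ H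
  ·∈ H≤ x∈H zero    = ε∈ H≤
  ·∈ H≤ x∈H (suc c) = ⊕∈ H≤ x∈H (·∈ H≤ x∈H c)

  _+ˢ_ : Subset qs → Subset qs → Subset qs
  H +ˢ K = ⟦ (λ x → searchᴱ (λ k → (k ∈ˢ? K) ×-dec ((x ⊕ neg k) ∈ˢ? H))) ⟧

  ∈+ˢ⁺ : ∀ H K {x} k → k ∈ˢ K → (x ⊕ neg k) ∈ˢ H → x ∈ˢ (H +ˢ K)
  ∈+ˢ⁺ H K k k∈K x-k∈H =
    ∈⟦⟧⁺ (λ x → searchᴱ (λ k → (k ∈ˢ? K) ×-dec ((x ⊕ neg k) ∈ˢ? H))) (k , k∈K , x-k∈H)

  ∈+ˢ⁻ : ∀ H K {x} → x ∈ˢ (H +ˢ K) → ∃ λ k → k ∈ˢ K × (x ⊕ neg k) ∈ˢ H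
  ∈+ˢ⁻ H K = ∈⟦⟧⁻ (λ x → searchᴱ (λ k → (k ∈ˢ? K) ×-dec ((x ⊕ neg k) ∈ˢ? H)))

  +ˢ-isSubgroup : ∀ {H K} → IsSubgroup qs H → IsSubgroup qs K → IsSubgroup qs (H +ˢ K)
  +ˢ-isSubgroup {H} {K} H≤ K≤ =
    (ε , ∈+ˢ⁺ H K ε (ε∈ K≤) (subst (_∈ˢ H) (sym (inverseʳ ε)) (ε∈ H≤))) , ⊕-closed , neg-closed
    where
    ⊕-closed : ∀ x y → x ∈ˢ (H +ˢ K) → y ∈ˢ (H +ˢ K) → (x ⊕ y) ∈ˢ (H +ˢ K)
    ⊕-closed x y x∈ y∈ with ∈+ˢ⁻ H K x∈ | ∈+ˢ⁻ H K y∈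
    ... | k , k∈K , x-k∈H | l , l∈K , y-l∈H =
      ∈+ˢ⁺ H K (k ⊕ l) (⊕∈ K≤ k∈K l∈K) (subst (_∈ˢ H) regroup (⊕∈ H≤ x-k∈H y-l∈H))
      where
      regroup : (x ⊕ neg k) ⊕ (y ⊕ neg l) ≡ (x ⊕ y) ⊕ neg (k ⊕ l)
      regroup = trans (interchange x (neg k) y (neg l)) (cong ((x ⊕ y) ⊕_) (⁻¹-∙-comm k l))

    neg-closed : ∀ x → x ∈ˢ (H +ˢ K) → neg x ∈ˢ (H +ˢ K)
    neg-closed x x∈ with ∈+ˢ⁻ H K x∈
    ... | k , k∈K , x-k∈H =
      ∈+ˢ⁺ H K (neg k) (neg∈ K≤ k∈K) (subst (_∈ˢ H) (sym (⁻¹-∙-comm x (neg k))) (neg∈ H≤ x-k∈H))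

  ⊆+ˢˡ : ∀ {H K} → IsSubgroup qs K → H ⊆ˢ (H +ˢ K)
  ⊆+ˢˡ {H} {K} K≤ x x∈H =
    ∈+ˢ⁺ H K ε (ε∈ K≤) (subst (_∈ˢ H) (sym (trans (cong (x ⊕_) ε⁻¹≈ε) (identityʳ x))) x∈H)

  ⊆+ˢʳ : ∀ {H K} → IsSubgroup qs H → K ⊆ˢ (H +ˢ K)
  ⊆+ˢʳ {H} {K} H≤ x x∈K = ∈+ˢ⁺ H K x x∈K (subst (_∈ˢ H) (sym (inverseʳ x)) (ε∈ H≤))

  +ˢ-least : ∀ {H K L} → IsSubgroup qs L → H ⊆ˢ L → K ⊆ˢ L → (H +ˢ K) ⊆ˢ L
  +ˢ-least {H} {K} {L} L≤ H⊆L K⊆L x x∈ with ∈+ˢ⁻ H K x∈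
  ... | k , k∈K , x-k∈H = subst (_∈ˢ L) ([x⊕-y]⊕y≡x x k) (⊕∈ L≤ (H⊆L _ x-k∈H) (K⊆L k k∈K))

  +ˢ-monoˡ : ∀ {H H′ K} → H ⊆ˢ H′ → (H +ˢ K) ⊆ˢ (H′ +ˢ K)
  +ˢ-monoˡ {H} {H′} {K} H⊆H′ x x∈ with ∈+ˢ⁻ H K x∈
  ... | k , k∈K , x-k∈H = ∈+ˢ⁺ H′ K k k∈K (H⊆H′ _ x-k∈H)

  whole-isSubgroup : IsSubgroup qs (λ _ → true)
  whole-isSubgroup = (ε , refl) , (λ _ _ _ _ → refl) , (λ _ _ → refl)

  ∩-isSubgroup : ∀ {H K} → IsSubgroup qs H → IsSubgroup qs K → IsSubgroup qs (λ x → H x ∧ K x)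
  ∩-isSubgroup {H} {K} H≤ K≤ = (ε , cong₂ _∧_ (ε∈ H≤) (ε∈ K≤))
    , (λ x y x∈ y∈ → cong₂ _∧_ (⊕∈ H≤ (left x x∈) (left y y∈))
                               (⊕∈ K≤ (right x x∈) (right y y∈)))
    , (λ x x∈ → cong₂ _∧_ (neg∈ H≤ (left x x∈)) (neg∈ K≤ (right x x∈)))
    where
    left : ∀ x → H x ∧ K x ≡ true → x ∈ˢ H
    left x = Bool.∧-conicalˡ (H x) (K x)
    right : ∀ x → H x ∧ K x ≡ true → x ∈ˢ K
    right x = Bool.∧-conicalʳ (H x) (K x)

  ⋂-isSubgroup : ∀ {𝒩} → All (IsSubgroup qs) 𝒩 → IsSubgroup qs (⋂ 𝒩)
  ⋂-isSubgroup []          = whole-isSubgroup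
  ⋂-isSubgroup (H≤ ∷ 𝒩≤) = ∩-isSubgroup H≤ (⋂-isSubgroup 𝒩≤)

  IsSubgroup-≗ : ∀ {H K} → (∀ x → H x ≡ K x) → IsSubgroup qs H → IsSubgroup qs K
  IsSubgroup-≗ {H} {K} H≗K ((x , x∈) , ⊕-closed , neg-closed) = (x , H⇒K x∈)
    , (λ x y x∈ y∈ → H⇒K (⊕-closed x y (K⇒H x∈) (K⇒H y∈)))
    , (λ x x∈ → H⇒K (neg-closed x (K⇒H x∈)))
    where
    H⇒K : ∀ {x} → x ∈ˢ H → x ∈ˢ K
    H⇒K {x} = trans (sym (H≗K x))
    K⇒H : ∀ {x} → x ∈ˢ K → x ∈ˢ H
    K⇒H {x} = trans (H≗K x)

  InI⇒IsSubgroup : ∀ {I} → InI qs I → IsSubgroup qs I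
  InI⇒IsSubgroup (𝒩 , _ , 𝒩-max , ⋂𝒩≗I) =
    IsSubgroup-≗ ⋂𝒩≗I (⋂-isSubgroup (All.map proj₁ 𝒩-max))

module Span {qs : List ℕ} (pos : All (0 <_) qs) (e : ℕ) .{{_ : NonZero e}}
            (exponent : ∀ x → ElGroup._·_ pos e x ≡ ElGroup.ε pos) where

  open ElGroup pos
  open Subgroups pos

  ·-mod : ∀ m x → (m % e) · x ≡ m · x
  ·-mod m x = sym (begin
    m · x                                ≡⟨ cong (_· x) (m≡m%n+[m/n]*n m e) ⟩
    (m % e + m / e * e) · x              ≡⟨ ·-homo-+ x (m % e) (m / e * e) ⟩
    (m % e) · x ⊕ (m / e * e) · x        ≡⟨ cong ((m % e) · x ⊕_) (·-assocˡ x (m / e) e) ⟨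
    (m % e) · x ⊕ (m / e) · (e · x)      ≡⟨ cong (λ t → (m % e) · x ⊕ (m / e) · t) (exponent x) ⟩
    (m % e) · x ⊕ (m / e) · ε            ≡⟨ cong ((m % e) · x ⊕_) (·-ε (m / e)) ⟩
    (m % e) · x ⊕ ε                      ≡⟨ identityʳ _ ⟩
    (m % e) · x                          ∎)
    where open ≡-Reasoning

  neg≡· : ∀ x → neg x ≡ pred e · x
  neg≡· x = sym (inverseʳ-unique x (pred e · x) (trans (cong (_· x) (suc-pred e)) (exponent x)))

  span : List (El qs) → List (El qs)
  span []      = ε ∷ []
  span (v ∷ F) = map (λ (c , s) → toℕ c · v ⊕ s) (cartesianProduct (allFin e) (span F))

  length-span : ∀ F → length (span F) ≡ e ^ length F
  length-span []      = refl
  length-span (v ∷ F) = begin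
    length (span (v ∷ F))                          ≡⟨ length-map _ (cartesianProduct (allFin e) (span F)) ⟩
    length (cartesianProduct (allFin e) (span F))  ≡⟨ length-cartesianProduct (allFin e) (span F) ⟩
    length (allFin e) * length (span F)            ≡⟨ cong₂ _*_ (length-allFin e) (length-span F) ⟩
    e * e ^ length F                               ∎
    where open ≡-Reasoning

  ∈-span-∷⁺ : ∀ v F {s} m → s ∈ span F → m · v ⊕ s ∈ span (v ∷ F)
  ∈-span-∷⁺ v F {s} m s∈ =
    subst (_∈ span (v ∷ F)) (cong (_⊕ s) (trans (cong (_· v) (toℕ-fromℕ< m%e<e)) (·-mod m v)))
          (∈-map⁺ (λ (c , s) → toℕ c · v ⊕ s) (∈-cartesianProduct⁺ (∈-allFin (fromℕ< m%e<e)) s∈))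
    where m%e<e = m%n<n m e

  ∈-span-∷⁻ : ∀ v F {x} → x ∈ span (v ∷ F) → ∃₂ λ m s → s ∈ span F × x ≡ m · v ⊕ s
  ∈-span-∷⁻ v F x∈ with ∈-map⁻ (λ (c , s) → toℕ c · v ⊕ s) x∈
  ... | (c , s) , cs∈ , refl = toℕ c , s , proj₂ (∈-cartesianProduct⁻ (allFin e) (span F) cs∈) , refl

  ε∈span : ∀ F → ε ∈ span F
  ε∈span []      = here refl
  ε∈span (v ∷ F) = subst (_∈ span (v ∷ F)) (identityˡ ε) (∈-span-∷⁺ v F 0 (ε∈span F))

  ⊆span : ∀ F → F ⊆ span F
  ⊆span (v ∷ F) (here refl) =
    subst (_∈ span (v ∷ F)) (trans (identityʳ _) (identityʳ v)) (∈-span-∷⁺ v F 1 (ε∈span F))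
  ⊆span (v ∷ F) (there x∈F) = subst (_∈ span (v ∷ F)) (identityˡ _) (∈-span-∷⁺ v F 0 (⊆span F x∈F))

  span-⊕ : ∀ F {x y} → x ∈ span F → y ∈ span F → x ⊕ y ∈ span F
  span-⊕ []      (here refl) (here refl) = here (identityˡ ε)
  span-⊕ (v ∷ F) x∈ y∈ with ∈-span-∷⁻ v F x∈ | ∈-span-∷⁻ v F y∈
  ... | m , s , s∈ , refl | n , t , t∈ , refl =
    subst (_∈ span (v ∷ F)) (sym regroup) (∈-span-∷⁺ v F (m + n) (span-⊕ F s∈ t∈))
    where
    regroup : (m · v ⊕ s) ⊕ (n · v ⊕ t) ≡ (m + n) · v ⊕ (s ⊕ t)
    regroup = trans (interchange (m · v) s (n · v) t) (cong (_⊕ (s ⊕ t)) (sym (·-homo-+ v m n)))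

  span-· : ∀ F {x} → x ∈ span F → ∀ m → m · x ∈ span F
  span-· F x∈ zero    = ε∈span F
  span-· F x∈ (suc m) = span-⊕ F x∈ (span-· F x∈ m)

  span-least : ∀ {H} → IsSubgroup qs H → ∀ F → All (_∈ˢ H) F → ∀ {x} → x ∈ span F → x ∈ˢ H
  span-least H≤ []      _           (here refl) = ε∈ H≤
  span-least H≤ (v ∷ F) (v∈H ∷ F⊆H) x∈ with ∈-span-∷⁻ v F x∈
  ... | m , s , s∈ , refl = ⊕∈ H≤ (·∈ H≤ v∈H m) (span-least H≤ F F⊆H s∈)

  ⟨_⟩ : List (El qs) → Subset qs
  ⟨ F ⟩ = ⟦ (λ x → ∈?[ _≟ᴱ_ ] x (span F)) ⟧

  ∈⟨⟩⁺ : ∀ F {x} → x ∈ span F → x ∈ˢ ⟨ F ⟩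
  ∈⟨⟩⁺ F = ∈⟦⟧⁺ (λ x → ∈?[ _≟ᴱ_ ] x (span F))

  ∈⟨⟩⁻ : ∀ F {x} → x ∈ˢ ⟨ F ⟩ → x ∈ span F
  ∈⟨⟩⁻ F = ∈⟦⟧⁻ (λ x → ∈?[ _≟ᴱ_ ] x (span F))

  ⟨⟩-isSubgroup : ∀ F → IsSubgroup qs ⟨ F ⟩
  ⟨⟩-isSubgroup F = (ε , ∈⟨⟩⁺ F (ε∈span F))
    , (λ x y x∈ y∈ → ∈⟨⟩⁺ F (span-⊕ F (∈⟨⟩⁻ F x∈) (∈⟨⟩⁻ F y∈)))
    , (λ x x∈ → ∈⟨⟩⁺ F (subst (_∈ span F) (sym (neg≡· x)) (span-· F (∈⟨⟩⁻ F x∈) (pred e))))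

  order≤ : ∀ F → Generates qs F → order qs ≤ e ^ length F
  order≤ F gen = subst (order qs ≤_) (length-span F)
    (Unique⇒length≤ _≟ᴱ_ (allEl-unique qs) (λ {x} _ → ∈⟨⟩⁻ F (gen ⟨ F ⟩ (⟨⟩-isSubgroup F) F⊆⟨F⟩ x)))
    where
    F⊆⟨F⟩ : All (_∈ˢ ⟨ F ⟩) F
    F⊆⟨F⟩ = All.tabulate (λ v∈F → ∈⟨⟩⁺ F (⊆span F v∈F))

module Maximal {qs : List ℕ} (pos : All (0 <_) qs) where

  open ElGroup pos
  open Subgroups pos
  open Span pos (product qs) {{product≢0 (All.map >-nonZero pos)}} (·-exponent pos (All.tabulate ∈⇒∣product))
    using (⟨_⟩; ⟨⟩-isSubgroup; ∈⟨⟩⁺; ∈⟨⟩⁻; ⊆span; span-least)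

  Proper : Subset qs → Set
  Proper H = ∃ λ x → H x ≡ false

  Absorbs : Subset qs → El qs → Set
  Absorbs M y = y ∈ˢ M ⊎ (∀ x → x ∈ˢ (M +ˢ ⟨ y ∷ [] ⟩))

  -- Absorption survives enlarging M, so one pass over all of G ends in a maximal
  -- subgroup.
  enlarge : ∀ ys {H} → IsSubgroup qs H → Proper H →
            Σ (Subset qs) λ M → IsSubgroup qs M × Proper M × H ⊆ˢ M × All (Absorbs M) ys
  enlarge []       {H} H≤ H≠G = H , H≤ , H≠G , (λ _ x∈ → x∈) , []
  enlarge (y ∷ ys) {H} H≤ H≠G with searchᴱ (λ w → (H +ˢ ⟨ y ∷ [] ⟩) w Bool.≟ false)
  ... | yes H+y≠G with enlarge ys (+ˢ-isSubgroup H≤ (⟨⟩-isSubgroup (y ∷ []))) H+y≠G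
  ...   | M , M≤ , M≠G , H+y⊆M , absorbs =
    M , M≤ , M≠G , (λ x x∈H → H+y⊆M x (⊆+ˢˡ {H} (⟨⟩-isSubgroup (y ∷ [])) x x∈H))
      , inj₁ (H+y⊆M y (⊆+ˢʳ H≤ y (∈⟨⟩⁺ (y ∷ []) (⊆span (y ∷ []) (here refl))))) ∷ absorbs
  enlarge (y ∷ ys) {H} H≤ H≠G | no H+y≡G with enlarge ys H≤ H≠G
  ...   | M , M≤ , M≠G , H⊆M , absorbs =
    M , M≤ , M≠G , H⊆M
      , inj₂ (λ x → +ˢ-monoˡ H⊆M x (Bool.¬-not (λ x∉ → H+y≡G (x , x∉)))) ∷ absorbs

  maximal-⊇ : ∀ {H} → IsSubgroup qs H → Proper H → Σ (Subset qs) λ M → IsMaximal qs M × H ⊆ˢ M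
  maximal-⊇ H≤ H≠G with enlarge (allEl qs) H≤ H≠G
  ... | M , M≤ , M≠G , H⊆M , absorbs = M , (M≤ , M≠G , maximality) , H⊆M
    where
    maximality : (K : Subset qs) → IsSubgroup qs K → M ⊆ˢ K →
                 ((x : El qs) → K x ≡ M x) ⊎ ((x : El qs) → x ∈ˢ K)
    maximality K K≤ M⊆K with searchᴱ (λ y → (y ∈ˢ? K) ×-dec (M y Bool.≟ false))
    ... | yes (y , y∈K , y∉M) with All.lookup absorbs (∈-allEl y)
    ...   | inj₁ y∈M = ⊥-elim (Bool.not-¬ y∈M y∉M)
    ...   | inj₂ M+y≡G = inj₂ (λ x → +ˢ-least K≤ M⊆K
              (λ z z∈ → span-least K≤ (y ∷ []) (y∈K ∷ []) (∈⟨⟩⁻ (y ∷ []) z∈)) x (M+y≡G x))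
    maximality K K≤ M⊆K | no K⊆M = inj₁ (λ x → same x)
      where
      same : ∀ x → K x ≡ M x
      same x with K x in Kx | M x in Mx
      ... | true  | true  = refl
      ... | false | false = refl
      ... | false | true  = ⊥-elim (Bool.not-¬ (M⊆K x Mx) Kx)
      ... | true  | false = ⊥-elim (K⊆M (x , Kx , Mx))

-- Generating quotients

module Hom {qs bs : List ℕ} (posG : All (0 <_) qs) (posA : All (0 <_) bs)
           (φ : El qs → El bs) (φ-hom : IsHom φ) where

  private
    module G = ElGroup posG
    module A = ElGroup posA
    module SG = Subgroups posG
    module SA = Subgroups posA

  φ-ε : φ G.ε ≡ A.ε
  φ-ε = A.identityʳ-unique (φ G.ε) (φ G.ε) (trans (sym (φ-hom G.ε G.ε)) (cong φ (G.identityʳ G.ε)))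

  φ-neg : ∀ x → φ (neg x) ≡ neg (φ x)
  φ-neg x = A.inverseʳ-unique (φ x) (φ (neg x))
    (trans (sym (φ-hom x (neg x))) (trans (cong φ (G.inverseʳ x)) φ-ε))

  preimage-isSubgroup : ∀ {K} → IsSubgroup bs K → IsSubgroup qs (λ x → K (φ x))
  preimage-isSubgroup {K} K≤ =
      (G.ε , subst (_∈ˢ K) (sym φ-ε) (SA.ε∈ K≤))
    , (λ x y x∈ y∈ → subst (_∈ˢ K) (sym (φ-hom x y)) (SA.⊕∈ K≤ x∈ y∈))
    , (λ x x∈ → subst (_∈ˢ K) (sym (φ-neg x)) (SA.neg∈ K≤ x∈))

  image? : ∀ H → Decidable (λ y → ∃ λ x → x ∈ˢ H × φ x ≡ y)
  image? H y = searchᴱ (λ x → (x ∈ˢ? H) ×-dec (φ x ≟ᴱ y))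

  image : Subset qs → Subset bs
  image H = ⟦ image? H ⟧

  ∈image⁺ : ∀ H {x} → x ∈ˢ H → φ x ∈ˢ image H
  ∈image⁺ H {x} x∈ = ∈⟦⟧⁺ (image? H) (x , x∈ , refl)

  ∈image⁻ : ∀ H {y} → y ∈ˢ image H → ∃ λ x → x ∈ˢ H × φ x ≡ y
  ∈image⁻ H = ∈⟦⟧⁻ (image? H)

  image-isSubgroup : ∀ {H} → IsSubgroup qs H → IsSubgroup bs (image H)
  image-isSubgroup {H} H≤ =
      (A.ε , subst (_∈ˢ image H) φ-ε (∈image⁺ H (SG.ε∈ H≤)))
    , ⊕-closed , neg-closed
    where
    ⊕-closed : ∀ y y′ → y ∈ˢ image H → y′ ∈ˢ image H → (y ⊕ y′) ∈ˢ image H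
    ⊕-closed _ _ y∈ y′∈ with ∈image⁻ H y∈ | ∈image⁻ H y′∈
    ... | x , x∈ , refl | x′ , x′∈ , refl =
      subst (_∈ˢ image H) (φ-hom x x′) (∈image⁺ H (SG.⊕∈ H≤ x∈ x′∈))

    neg-closed : ∀ y → y ∈ˢ image H → neg y ∈ˢ image H
    neg-closed _ y∈ with ∈image⁻ H y∈
    ... | x , x∈ , refl = subst (_∈ˢ image H) (φ-neg x) (∈image⁺ H (SG.neg∈ H≤ x∈))

  generates-image : (∀ y → ∃ λ x → φ x ≡ y) → ∀ P E → All (λ x → φ x ≡ A.ε) P →
                    Generates qs (P ++ E) → Generates bs (map φ E)
  generates-image surj P E φP≡ε gen K K≤ φE⊆K y with surj y
  ... | x , refl = gen (λ x → K (φ x)) (preimage-isSubgroup K≤) (All.++⁺ P⊆φ⁻¹K (All.map⁻ φE⊆K)) x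
    where
    P⊆φ⁻¹K : All (λ x → φ x ∈ˢ K) P
    P⊆φ⁻¹K = All.map (λ φx≡ε → subst (_∈ˢ K) (sym φx≡ε) (SA.ε∈ K≤)) φP≡ε

positive : ∀ {αs} → All (2 ≤_) αs → All (0 <_) αs
positive []                    = []
positive (s≤s (s≤s z≤n) ∷ two) = s≤s z≤n ∷ positive two

basis : ∀ {αs} → All (2 ≤_) αs → List (El αs)
basis []                    = []
basis (s≤s (s≤s z≤n) ∷ two) = (Fin.suc Fin.zero , 0ᴱ (positive two)) ∷ map (Fin.zero ,_) (basis two)

length-basis : ∀ {αs} (two : All (2 ≤_) αs) → length (basis two) ≡ length αs
length-basis []                    = refl
length-basis (s≤s (s≤s z≤n) ∷ two) = cong suc (trans (length-map _ (basis two)) (length-basis two))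

basis-generates : ∀ {αs} (two : All (2 ≤_) αs) → Generates αs (basis two)
basis-generates []                        H ((tt , tt∈H) , _) _ tt = tt∈H
basis-generates {suc (suc n) ∷ αs} (s≤s (s≤s z≤n) ∷ two) H H≤ (e₁∈H ∷ rest∈H) (a , y) =
  subst (_∈ˢ H) (cong₂ _,_ (trans (addF-comm a Fin.zero) (addF-identityˡ a)) (ElGroup.identityˡ pos y))
        (⊕∈ H≤ a∈H y∈H)
  where
  pos = positive two
  open Subgroups (s≤s z≤n ∷ pos)

  slice : Subset αs
  slice w = H (Fin.zero , w)

  slice-isSubgroup : IsSubgroup αs slice
  slice-isSubgroup = (0ᴱ pos , ε∈ H≤)
    , (λ x x′ x∈ x′∈ → subst (_∈ˢ H) (cong (_, x ⊕ x′) (addF-identityˡ Fin.zero)) (⊕∈ H≤ x∈ x′∈))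
    , (λ x x∈ → subst (_∈ˢ H) (cong (_, neg x) negF-zero) (neg∈ H≤ x∈))

  y∈H : (Fin.zero , y) ∈ˢ H
  y∈H = basis-generates two slice slice-isSubgroup (All.map⁻ rest∈H) y

  a·e₁≡a : ElGroup._·_ (s≤s z≤n ∷ pos) (toℕ a) (Fin.suc Fin.zero , 0ᴱ pos) ≡ (a , 0ᴱ pos)
  a·e₁≡a = trans (·-cons pos (toℕ a) (Fin.suc Fin.zero) (0ᴱ pos))
    (cong₂ _,_ (toℕ-injective (trans (toℕ-·ᶠ (toℕ a) (Fin.suc Fin.zero))
                 (trans (cong (_% suc (suc n)) (*-identityʳ (toℕ a))) (m<n⇒m%n≡m (toℕ<n a)))))
               (ElGroup.·-ε pos (toℕ a)))

  a∈H : (a , 0ᴱ pos) ∈ˢ H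
  a∈H = subst (_∈ˢ H) a·e₁≡a (·∈ H≤ e₁∈H (toℕ a))

module Reduction (n : ℕ) where

  modF : ∀ {α} → Fin α → Fin (suc n)
  modF x = fromℕ< (m%n<n (toℕ x) (suc n))

  toℕ-modF : ∀ {α} (x : Fin α) → toℕ (modF x) ≡ toℕ x % suc n
  toℕ-modF x = toℕ-fromℕ< (m%n<n (toℕ x) (suc n))

  reduce : ∀ {αs} → El αs → El (replicate (length αs) (suc n))
  reduce {[]}     tt      = tt
  reduce {α ∷ αs} (x , y) = modF x , reduce y

  replicate-positive : ∀ m → All (0 <_) (replicate m (suc n))
  replicate-positive zero    = []
  replicate-positive (suc m) = s≤s z≤n ∷ replicate-positive m

  modF-hom : ∀ {α} → suc n ∣ α → (x y : Fin α) → modF (addF x y) ≡ addF (modF x) (modF y)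
  modF-hom {suc α} n∣α x y = toℕ-injective (begin
    toℕ (modF (addF x y))                    ≡⟨ toℕ-modF (addF x y) ⟩
    toℕ (addF x y) % suc n                   ≡⟨ cong (_% suc n) (toℕ-addF x y) ⟩
    (toℕ x + toℕ y) % suc α % suc n          ≡⟨ m∣n⇒o%n%m≡o%m (suc n) (suc α) (toℕ x + toℕ y) n∣α ⟩
    (toℕ x + toℕ y) % suc n                  ≡⟨ %-distribˡ-+ (toℕ x) (toℕ y) (suc n) ⟩
    (toℕ x % suc n + toℕ y % suc n) % suc n  ≡⟨ cong₂ (λ u v → (u + v) % suc n) (toℕ-modF x) (toℕ-modF y) ⟨
    (toℕ (modF x) + toℕ (modF y)) % suc n    ≡⟨ toℕ-addF (modF x) (modF y) ⟨
    toℕ (addF (modF x) (modF y))             ∎)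
    where open ≡-Reasoning

  reduce-hom : ∀ {αs} → All (suc n ∣_) αs → IsHom (reduce {αs})
  reduce-hom []          x       y       = refl
  reduce-hom (n∣α ∷ n∣αs) (x , u) (y , v) = cong₂ _,_ (modF-hom n∣α x y) (reduce-hom n∣αs u v)

  reduce-ε : ∀ {αs} (pos : All (0 <_) αs) → reduce (0ᴱ pos) ≡ 0ᴱ (replicate-positive (length αs))
  reduce-ε []              = refl
  reduce-ε (s≤s z≤n ∷ pos) = cong (Fin.zero ,_) (reduce-ε pos)

  reduce-surjective : ∀ {αs} → All (suc n ∣_) αs → All (0 <_) αs → ∀ w → ∃ λ y → reduce {αs} y ≡ w
  reduce-surjective []           []              tt      = tt , refl
  reduce-surjective (n∣α ∷ n∣αs) (s≤s z≤n ∷ pos) (c , w) with reduce-surjective n∣αs pos w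
  ... | y , y↦w = (fromℕ< c<α , y) , cong₂ _,_ modF-c≡c y↦w
    where
    c<α = <-≤-trans (toℕ<n c) (∣⇒≤ n∣α)
    modF-c≡c : modF (fromℕ< c<α) ≡ c
    modF-c≡c = toℕ-injective (begin
      toℕ (modF (fromℕ< c<α))  ≡⟨ toℕ-modF (fromℕ< c<α) ⟩
      toℕ (fromℕ< c<α) % suc n ≡⟨ cong (_% suc n) (toℕ-fromℕ< c<α) ⟩
      toℕ c % suc n            ≡⟨ m<n⇒m%n≡m (toℕ<n c) ⟩
      toℕ c                    ∎)
      where open ≡-Reasoning

lower-bound : ∀ {qs αs} (posG : All (0 <_) qs) (two : All (2 ≤_) αs) → Linked _∣_ αs →
  (φ : El qs → El αs) → IsHom φ → (∀ y → ∃ λ x → φ x ≡ y) →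
  ∀ P E → All (λ x → φ x ≡ 0ᴱ (positive two)) P → Generates qs (P ++ E) → length αs ≤ length E
lower-bound posG [] _ _ _ _ _ _ _ _ = z≤n
lower-bound {qs} {suc (suc n) ∷ αs} posG two@(s≤s (s≤s z≤n) ∷ _) linked φ φ-hom surj P E φP≡ε gen =
  ≮⇒≥ (λ |E|<m → <⇒≱ (^-monoʳ-< a (s≤s (s≤s z≤n)) |E|<m) a^m≤a^|E|)
  where
  a = suc (suc n)
  m = length (a ∷ αs)
  open Reduction (suc n)
  a∣αs = Linked⇒All ∣-trans ∣-refl linked
  posR = replicate-positive m

  χ : El qs → El (replicate m a)
  χ x = reduce (φ x)

  χ-hom : IsHom χ
  χ-hom x y = trans (cong reduce (φ-hom x y)) (reduce-hom a∣αs (φ x) (φ y))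

  χ-surjective : ∀ w → ∃ λ x → χ x ≡ w
  χ-surjective w = let (y , y↦w) = reduce-surjective a∣αs (positive two) w ; (x , x↦y) = surj y in
    x , trans (cong reduce x↦y) y↦w

  χP≡ε : All (λ x → χ x ≡ 0ᴱ posR) P
  χP≡ε = All.map (λ φx≡ε → trans (cong reduce φx≡ε) (reduce-ε (positive two))) φP≡ε

  a^m≤a^|E| : a ^ m ≤ a ^ length E
  a^m≤a^|E| = subst₂ _≤_ (trans (order≡product (replicate m a)) (product-replicate m a))
                         (cong (a ^_) (length-map χ E))
    (Span.order≤ posR a (·-exponent posR (All.replicate⁺ m ∣-refl)) (map χ E)
      (Hom.generates-image posG posR χ χ-hom χ-surjective P E χP≡ε gen))

-- The deficiency of a position

record Deficiency {qs : List ℕ} (P : List (El qs)) (k : ℕ) : Set where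
  field
    completion        : List (El qs)
    length-completion : length completion ≡ k
    generates         : Generates qs (P ++ completion)
    minimal           : ∀ E → length E < k → ¬ Generates qs (P ++ E)

module _ {qs : List ℕ} where

  Generates-mono : ∀ {P Q : List (El qs)} → P ⊆ Q → Generates qs P → Generates qs Q
  Generates-mono P⊆Q gen H H≤ Q⊆H = gen H H≤ (All.tabulate (λ x∈P → All.lookup Q⊆H (P⊆Q x∈P)))

  Generates-↭ : ∀ {P Q : List (El qs)} → P ↭ Q → Generates qs P → Generates qs Q
  Generates-↭ P↭Q = Generates-mono (∈-resp-↭ P↭Q)

  deficiency-zero : ∀ {P} → Deficiency P 0 → Generates qs P
  deficiency-zero {P} record { completion = [] ; generates = gen } = subst (Generates qs) (++-identityʳ P) gen

  deficiency-suc : ∀ {P k} → Deficiency P (suc k) → ¬ Generates qs P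
  deficiency-suc {P} d gen = Deficiency.minimal d [] z<s (subst (Generates qs) (sym (++-identityʳ P)) gen)

  extend-minimal : ∀ {P k g} → Deficiency P (suc k) → ∀ E → length E < k → ¬ Generates qs (g ∷ P ++ E)
  extend-minimal {P} {g = g} d E |E|<k gen =
    Deficiency.minimal d (g ∷ E) (s≤s |E|<k) (Generates-↭ (↭-sym (shift g P E)) gen)

  deficiency-drop : ∀ {P k} → Deficiency P (suc k) → ∃ λ g → g ∉ P × Deficiency (g ∷ P) k
  deficiency-drop {P} {k} d@record { completion = g ∷ E ; length-completion = len ; generates = gen } =
    g , g∉P , record
      { completion        = E
      ; length-completion = suc-injective len
      ; generates         = Generates-↭ (shift g P E) gen
      ; minimal           = extend-minimal d }
    where
    g∉P : g ∉ P
    g∉P g∈P = Deficiency.minimal d E (≤-reflexive len) (Generates-mono drop-g gen)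
      where
      drop-g : P ++ g ∷ E ⊆ P ++ E
      drop-g x∈ with ∈-++⁻ P x∈
      ... | inj₁ x∈P         = ∈-++⁺ˡ x∈P
      ... | inj₂ (here refl) = ∈-++⁺ˡ g∈P
      ... | inj₂ (there x∈E) = ∈-++⁺ʳ P x∈E

  deficiency-redundant : ∀ {P k g} → (∀ H → IsSubgroup qs H → All (_∈ˢ H) P → g ∈ˢ H) →
                         Deficiency P k → Deficiency (g ∷ P) k
  deficiency-redundant {P} {k} {g} g∈⟨P⟩ d = record
    { completion        = completion
    ; length-completion = length-completion
    ; generates         = Generates-mono (xs⊆x∷xs _ g) generates
    ; minimal           = λ E |E|<k gen → minimal E |E|<k λ H H≤ P++E⊆H →
        gen H H≤ (g∈⟨P⟩ H H≤ (All.++⁻ˡ P P++E⊆H) ∷ P++E⊆H) }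
    where open Deficiency d

  deficiency-step : ∀ {P k g} → Deficiency P (suc k) →
                    ¬ ¬ (Deficiency (g ∷ P) k ⊎ Deficiency (g ∷ P) (suc k))
  deficiency-step {P} {k} {g} d neither = neither (inj₂ record
    { completion        = completion
    ; length-completion = length-completion
    ; generates         = Generates-mono (xs⊆x∷xs _ g) generates
    ; minimal           = minimal′ })
    where
    open Deficiency d
    minimal′ : ∀ E → length E < suc k → ¬ Generates qs (g ∷ P ++ E)
    minimal′ E |E|<1+k gen with m<1+n⇒m<n∨m≡n |E|<1+k
    ... | inj₁ |E|<k = extend-minimal d E |E|<k gen
    ... | inj₂ |E|≡k = neither (inj₁ record
      { completion = E ; length-completion = |E|≡k ; generates = gen ; minimal = extend-minimal d })

  everything-generates : ∀ {P} → (∀ x → x ∈ P) → Generates qs P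
  everything-generates ∈P H H≤ P⊆H x = All.lookup P⊆H (∈P x)

  full-position : ∀ {P} → Unique P → order qs ≤ length P → ∀ x → x ∈ P
  full-position {P} u full x with ∈?[ _≟ᴱ_ ] x P
  ... | yes x∈P = x∈P
  ... | no  x∉P = ⊥-elim (<⇒≱ (s≤s full) (Unique⇒length≤ _≟ᴱ_ {ys = allEl qs} x∷P-unique (λ {y} _ → ∈-allEl y)))
    where x∷P-unique = All.¬Any⇒All¬ P x∉P ∷ u

module Quotient {qs αs : List ℕ} (posG : All (0 <_) qs) (two : All (2 ≤_) αs) (linked : Linked _∣_ αs)
                (φ : El qs → El αs) (φ-hom : IsHom φ) (surj : ∀ y → ∃ λ x → φ x ≡ y) where

  private
    module G = ElGroup posG
    module A = ElGroup (positive two)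
    open Subgroups posG
    open Hom posG (positive two) φ φ-hom

  lifts : List (El qs)
  lifts = map (λ y → proj₁ (surj y)) (basis two)

  length-lifts : length lifts ≡ length αs
  length-lifts = trans (length-map _ (basis two)) (length-basis two)

  lifts-cover : ∀ {H} → IsSubgroup qs H → All (_∈ˢ H) lifts → ∀ x → ∃ λ h → h ∈ˢ H × φ h ≡ φ x
  lifts-cover {H} H≤ lifts⊆H x =
    ∈image⁻ H (basis-generates two (image H) (image-isSubgroup H≤) basis⊆φ[H] (φ x))
    where
    basis⊆φ[H] : All (_∈ˢ image H) (basis two)
    basis⊆φ[H] = All.tabulate λ {y} y∈ →
      subst (_∈ˢ image H) (proj₂ (surj y)) (∈image⁺ H (All.lookup lifts⊆H (∈-map⁺ _ y∈)))

  lifts+kernel-generate : ∀ {H} → IsSubgroup qs H → All (_∈ˢ H) lifts → (∀ x → φ x ≡ A.ε → x ∈ˢ H) →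
                          ∀ x → x ∈ˢ H
  lifts+kernel-generate {H} H≤ lifts⊆H kernel⊆H x with lifts-cover H≤ lifts⊆H x
  ... | h , h∈H , φh≡φx = subst (_∈ˢ H) (G.[x⊕-y]⊕y≡x x h) (⊕∈ H≤ (kernel⊆H _ φ[x-h]≡ε) h∈H)
    where
    φ[x-h]≡ε : φ (x ⊕ neg h) ≡ A.ε
    φ[x-h]≡ε = begin
      φ (x ⊕ neg h)        ≡⟨ φ-hom x (neg h) ⟩
      φ x ⊕ φ (neg h)      ≡⟨ cong (φ x ⊕_) (trans (φ-neg h) (cong neg φh≡φx)) ⟩
      φ x ⊕ neg (φ x)      ≡⟨ A.inverseʳ (φ x) ⟩
      A.ε                  ∎
      where open ≡-Reasoning

  deficiency : ∀ P → All (λ x → φ x ≡ A.ε) P → Generates qs (P ++ lifts) → Deficiency P (length αs)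
  deficiency P φP≡ε gen = record
    { completion        = lifts
    ; length-completion = length-lifts
    ; generates         = gen
    ; minimal           = λ E |E|<m gen′ →
        <⇒≱ |E|<m (lower-bound posG two linked φ φ-hom surj P E φP≡ε gen′)
    }

spread-deficiency : ∀ {qs m} (pos : All (0 <_) qs) → Spread qs m → Deficiency [] m
spread-deficiency pos (αs , refl , two , linked , φ , φ-hom , surj , ker) =
  deficiency [] [] λ H H≤ lifts⊆H → lifts+kernel-generate H≤ lifts⊆H (kernel⊆ H≤)
  where
  open Quotient pos two linked φ φ-hom surj
  kernel⊆ : ∀ {H} → IsSubgroup _ H → ∀ x → φ x ≡ 0ᴱ (positive two) → x ∈ˢ H
  kernel⊆ {H} H≤ x φx≡ε = subst (_∈ˢ H)
    (sym (trivialSub⇒≡0ᴱ pos (Equivalence.from (ker x) (≡0ᴱ⇒IsZero (positive two) φx≡ε))))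
    (Subgroups.ε∈ pos H≤)

module _ {qs : List ℕ} (pos : All (0 <_) qs) where

  open Subgroups pos
  open Maximal pos

  X⇒⊆maximal : ∀ {I P M} → InI qs I → InX qs I P → IsMaximal qs M → All (_∈ˢ M) P → I ⊆ˢ M
  X⇒⊆maximal {I} {P} {M} (𝒩 , _ , 𝒩-max , ⋂𝒩≗I) (_ , P⊆I , minimal) M-max P⊆M t t∈I with M t in Mt
  ... | true  = refl
  ... | false = ⊥-elim (minimal J J∈𝓘 (J⊆I , t , t∈I , cong (_∧ ⋂ 𝒩 t) Mt) P⊆J)
    where
    J : Subset qs
    J = ⋂ (M ∷ 𝒩)
    J∈𝓘 : InI qs J
    J∈𝓘 = M ∷ 𝒩 , (λ ()) , M-max ∷ 𝒩-max , (λ _ → refl)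
    J⊆I : J ⊆ˢ I
    J⊆I x x∈J = trans (sym (⋂𝒩≗I x)) (Bool.∧-conicalʳ (M x) (⋂ 𝒩 x) x∈J)
    P⊆J : All (_∈ˢ J) P
    P⊆J = All.zipWith (λ (p∈M , p∈I) → cong₂ _∧_ p∈M (trans (⋂𝒩≗I _) p∈I)) (P⊆M , P⊆I)

  X-deficiency : ∀ {I P m} → InI qs I → SpreadQuot qs I m → InX qs I P → Deficiency P m
  X-deficiency {I} {P} I∈𝓘 (αs , refl , two , linked , φ , φ-hom , surj , ker) P∈X@(_ , P⊆I , _) =
    deficiency P (All.map (IsZero⇒≡0ᴱ (positive two) ∘ Equivalence.to (ker _)) P⊆I) generates
    where
    open Quotient pos two linked φ φ-hom surj
    generates : Generates qs (P ++ lifts)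
    generates H H≤ P++lifts⊆H x with H x in Hx
    ... | true  = refl
    ... | false with maximal-⊇ H≤ (x , Hx)
    ...   | M , M-max@(M≤ , (w , w∉M) , _) , H⊆M = ⊥-elim (Bool.not-¬ (M-everything w) w∉M)
      where
      P++lifts⊆M = All.map (H⊆M _) P++lifts⊆H
      I⊆M = X⇒⊆maximal I∈𝓘 P∈X M-max (All.++⁻ˡ P P++lifts⊆M)
      M-everything : ∀ y → y ∈ˢ M
      M-everything = lifts+kernel-generate M≤ (All.++⁻ʳ P P++lifts⊆M)
        (λ y φy≡ε → I⊆M y (Equivalence.from (ker y) (≡0ᴱ⇒IsZero (positive two) φy≡ε)))

deficiencyNim : ℕ → Parity → ℕ
deficiencyNim zero                _  = 0
deficiencyNim 1                   0ℙ = 2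
deficiencyNim 1                   1ℙ = 1
deficiencyNim 2                   0ℙ = 2
deficiencyNim 2                   1ℙ = 0
deficiencyNim (suc (suc (suc _))) 0ℙ = 1
deficiencyNim (suc (suc (suc _))) 1ℙ = 0

deficiencyNim-mex : ∀ k p m → m < deficiencyNim (suc k) p →
  m ≡ deficiencyNim k (p ⁻¹) ⊎ (p ≡ 0ℙ × m ≡ deficiencyNim (suc k) (p ⁻¹))
deficiencyNim-mex zero                0ℙ 0 _ = inj₁ refl
deficiencyNim-mex zero                0ℙ 1 _ = inj₂ (refl , refl)
deficiencyNim-mex zero                1ℙ 0 _ = inj₁ refl
deficiencyNim-mex 1                   0ℙ 0 _ = inj₂ (refl , refl)
deficiencyNim-mex 1                   0ℙ 1 _ = inj₁ refl
deficiencyNim-mex 2                   0ℙ 0 _ = inj₁ refl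
deficiencyNim-mex (suc (suc (suc _))) 0ℙ 0 _ = inj₁ refl
deficiencyNim-mex zero                0ℙ (suc (suc _)) (s≤s (s≤s ()))
deficiencyNim-mex zero                1ℙ (suc _)       (s≤s ())
deficiencyNim-mex 1                   0ℙ (suc (suc _)) (s≤s (s≤s ()))
deficiencyNim-mex 2                   0ℙ (suc _)       (s≤s ())
deficiencyNim-mex (suc (suc (suc _))) 0ℙ (suc _)       (s≤s ())

deficiencyNim-excluded : ∀ k p → deficiencyNim (suc k) p ≢ deficiencyNim k (p ⁻¹)
                               × deficiencyNim (suc k) p ≢ deficiencyNim (suc k) (p ⁻¹)
deficiencyNim-excluded zero                0ℙ = (λ ()) , (λ ())
deficiencyNim-excluded zero                1ℙ = (λ ()) , (λ ())
deficiencyNim-excluded 1                   0ℙ = (λ ()) , (λ ())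
deficiencyNim-excluded 1                   1ℙ = (λ ()) , (λ ())
deficiencyNim-excluded 2                   0ℙ = (λ ()) , (λ ())
deficiencyNim-excluded 2                   1ℙ = (λ ()) , (λ ())
deficiencyNim-excluded (suc (suc (suc _))) 0ℙ = (λ ()) , (λ ())
deficiencyNim-excluded (suc (suc (suc _))) 1ℙ = (λ ()) , (λ ())

parity-suc : ∀ n → parity (suc n) ≡ parity n ⁻¹
parity-suc zero          = refl
parity-suc (suc zero)    = refl
parity-suc (suc (suc n)) = parity-suc n

NimIs-functional : ∀ {qs} f (P : List (El qs)) {m n} → NimIs qs f P m → NimIs qs f P n → m ≡ n
NimIs-functional zero    P m≡0 n≡0 = trans m≡0 (sym n≡0)
NimIs-functional (suc f) P (inj₁ (_ , m≡0)) (inj₁ (_ , n≡0)) = trans m≡0 (sym n≡0)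
NimIs-functional (suc f) P (inj₁ (gen , _)) (inj₂ (¬gen , _)) = ⊥-elim (¬gen gen)
NimIs-functional (suc f) P (inj₂ (¬gen , _)) (inj₁ (gen , _)) = ⊥-elim (¬gen gen)
NimIs-functional (suc f) P {m} {n} (inj₂ (_ , mex-m , excl-m)) (inj₂ (_ , mex-n , excl-n)) with <-cmp m n
... | tri≈ _ m≡n _ = m≡n
... | tri< m<n _ _ = let (g , g∉P , nim) = mex-n m m<n in ⊥-elim (excl-m g g∉P nim)
... | tri> _ _ n<m = let (g , g∉P , nim) = mex-m n n<m in ⊥-elim (excl-n g g∉P nim)

bit : Parity → ℕ
bit 0ℙ = 0
bit 1ℙ = 1

pty≡bit∘parity : ∀ n → pty n ≡ bit (parity n)
pty≡bit∘parity zero          = refl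
pty≡bit∘parity (suc zero)    = refl
pty≡bit∘parity (suc (suc n)) = pty≡bit∘parity n

pty≡bit⇒parity≡ : ∀ n {p} → pty n ≡ bit p → parity n ≡ p
pty≡bit⇒parity≡ n {p} eq = bit-injective (trans (sym (pty≡bit∘parity n)) eq)
  where
  bit-injective : ∀ {p q} → bit p ≡ bit q → p ≡ q
  bit-injective {0ℙ} {0ℙ} _ = refl
  bit-injective {1ℙ} {1ℙ} _ = refl

typeTable≡ : ∀ m → typeTable m ≡ (1 , deficiencyNim m 0ℙ , deficiencyNim m 1ℙ)
typeTable≡ 0                   = refl
typeTable≡ 1                   = refl
typeTable≡ 2                   = refl
typeTable≡ (suc (suc (suc _))) = refl

nimTable≡ : ∀ m → nimTable m ≡ deficiencyNim m 0ℙ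
nimTable≡ 0                   = refl
nimTable≡ 1                   = refl
nimTable≡ 2                   = refl
nimTable≡ (suc (suc (suc _))) = refl

spread-of-whole : ∀ {qs m} → SpreadQuot qs (λ _ → true) m → m ≡ 0
spread-of-whole ([] , len , _) = sym len
spread-of-whole (_ ∷ _ , _ , s≤s (s≤s z≤n) ∷ two , _ , φ , _ , surj , ker)
  with surj (Fin.suc Fin.zero , 0ᴱ (positive two))
... | x , φx≡e₁ with () ← proj₁ (subst IsZero φx≡e₁ (Equivalence.to (ker x) refl))

module OddOrder {qs : List ℕ} (pos : All (0 <_) qs) (neg-fixed⇒ε : ∀ x → neg x ≡ x → x ≡ 0ᴱ pos) where

  open ElGroup pos
  open Subgroups pos

  neg-closed-odd : ∀ {L} → Unique L → ε ∈ L → (∀ {y} → y ∈ L → neg y ∈ L) → parity (length L) ≡ 1ℙ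
  neg-closed-odd {L} = closed-odd _≟ᴱ_ neg ε ⁻¹-involutive ε⁻¹≈ε neg-fixed⇒ε (length L) refl

  order-odd : parity (order qs) ≡ 1ℙ
  order-odd = neg-closed-odd (allEl-unique qs) (∈-allEl ε) (λ {y} _ → ∈-allEl (neg y))

  card-odd : ∀ {H} → IsSubgroup qs H → parity (card H) ≡ 1ℙ
  card-odd {H} H≤ = neg-closed-odd (Unique.filter⁺ (T? ∘ H) (allEl-unique qs)) (∈H-list (ε∈ H≤))
    (λ {y} y∈ → ∈H-list (neg∈ H≤ (Equivalence.to Bool.T-≡ (proj₂ (∈-filter⁻ (T? ∘ H) {xs = allEl qs} y∈)))))
    where
    ∈H-list : ∀ {x} → x ∈ˢ H → x ∈ filterᵇ H (allEl qs)
    ∈H-list {x} x∈H = ∈-filter⁺ (T? ∘ H) (∈-allEl x) (Equivalence.from Bool.T-≡ x∈H)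

  redundant-element : ∀ {P} → Unique P → parity (length P) ≡ 0ℙ →
                      ∃ λ g → g ∉ P × (∀ H → IsSubgroup qs H → All (_∈ˢ H) P → g ∈ˢ H)
  redundant-element {P} u even with ∈?[ _≟ᴱ_ ] ε P
  ... | no ε∉P = ε , ε∉P , λ H H≤ _ → ε∈ H≤
  ... | yes ε∈P with All.all? (λ y → ∈?[ _≟ᴱ_ ] (neg y) P) P
  ...   | yes closed =
    ⊥-elim (Parity.p≢p⁻¹ 0ℙ (trans (sym even) (neg-closed-odd u ε∈P (All.lookup closed))))
  ...   | no ¬closed with find (All.¬All⇒Any¬ (λ y → ∈?[ _≟ᴱ_ ] (neg y) P) P ¬closed)
  ...     | x , x∈P , -x∉P = neg x , -x∉P , λ H H≤ P⊆H → neg∈ H≤ (All.lookup P⊆H x∈P)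

  nimIs-deficiency : ∀ f {P k} → order qs ∸ length P ≡ f → Unique P → Deficiency P k →
                    NimIs qs f P (deficiencyNim k (parity (length P)))
  nimIs-deficiency zero    {k = zero}  _    _ _ = refl
  nimIs-deficiency (suc f) {k = zero}  _    _ d = inj₁ (deficiency-zero d , refl)
  nimIs-deficiency zero    {k = suc k} full u d =
    ⊥-elim (deficiency-suc d (everything-generates (full-position u (m∸n≡0⇒m≤n full))))
  nimIs-deficiency (suc f) {P} {suc k} rest u d = inj₂ (deficiency-suc d , mex , excluded)
    where
    p = parity (length P)

    option : ∀ {g j} → g ∉ P → Deficiency (g ∷ P) j → NimIs qs f (g ∷ P) (deficiencyNim j (p ⁻¹))
    option {g} {j} g∉P d′ = subst (NimIs qs f (g ∷ P) ∘ deficiencyNim j) (parity-suc (length P))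
      (nimIs-deficiency f (trans (sym (pred[m∸n]≡m∸[1+n] (order qs) (length P))) (cong pred rest))
                         (All.¬Any⇒All¬ P g∉P ∷ u) d′)

    mex : ∀ m → m < deficiencyNim (suc k) p → ∃ λ g → g ∉ P × NimIs qs f (g ∷ P) m
    mex m m< with deficiencyNim-mex k p m m<
    ... | inj₁ refl = let (g , g∉P , d′) = deficiency-drop d in g , g∉P , option g∉P d′
    ... | inj₂ (even , refl) = let (g , g∉P , g∈⟨P⟩) = redundant-element u even in
      g , g∉P , option g∉P (deficiency-redundant g∈⟨P⟩ d)

    excluded : ∀ g → g ∉ P → ¬ NimIs qs f (g ∷ P) (deficiencyNim (suc k) p)
    excluded g g∉P nim = deficiency-step d λ where
      (inj₁ d′) → proj₁ (deficiencyNim-excluded k p) (NimIs-functional f (g ∷ P) nim (option g∉P d′))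
      (inj₂ d′) → proj₂ (deficiencyNim-excluded k p) (NimIs-functional f (g ∷ P) nim (option g∉P d′))

  nim-deficiency : ∀ {P k} → Unique P → Deficiency P k → Nim qs P (deficiencyNim k (parity (length P)))
  nim-deficiency = nimIs-deficiency _ refl

  X-type : ∀ {I m} → IsSubgroup qs I → (∀ P → InX qs I P → Deficiency P m) → HasType qs I (typeTable m)
  X-type {I} {m} I≤ deficient = subst (HasType qs I) (sym (typeTable≡ m))
      (trans (pty≡bit∘parity (card I)) (cong bit (card-odd I≤))
    , (λ P P∈X even → subst (Nim qs P ∘ deficiencyNim m) (pty≡bit⇒parity≡ (length P) even)
                            (nim-deficiency (proj₁ P∈X) (deficient P P∈X)))
    , (λ P P∈X odd → subst (Nim qs P ∘ deficiencyNim m) (pty≡bit⇒parity≡ (length P) odd)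
                           (nim-deficiency (proj₁ P∈X) (deficient P P∈X))))

Odd : ℕ → Set
Odd q = q % 2 ≡ 1

odd-^ : ∀ p r → Odd p → Odd (p ^ r)
odd-^ p zero    _     = refl
odd-^ p (suc r) p-odd = trans (%-distribˡ-* p (p ^ r) 2) (cong₂ (λ u v → (u * v) % 2) p-odd (odd-^ p r p-odd))

odd-moduli : ∀ fs → All OddPrimePower fs → All Odd (moduli fs)
odd-moduli []             []                  = []
odd-moduli ((p , r) ∷ fs) ((_ , p-odd , _) ∷ ofs) = odd-^ p r p-odd ∷ odd-moduli fs ofs

odd⇒positive : ∀ {qs} → All Odd qs → All (0 <_) qs
odd⇒positive {[]}        []         = []
odd⇒positive {suc _ ∷ _} (_ ∷ odds) = s≤s z≤n ∷ odd⇒positive odds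

negF-fixed⇒zero : ∀ {n} → Odd (suc n) → (a : Fin (suc n)) → negF a ≡ a → a ≡ Fin.zero
negF-fixed⇒zero         _     Fin.zero    _     = refl
negF-fixed⇒zero {n} odd (Fin.suc b) fixed = ⊥-elim (0≢1+n (begin
  0                      ≡⟨ m*n%n≡0 (suc t) 2 ⟨
  (suc t * 2) % 2        ≡⟨ cong (_% 2) (trans (*-comm (suc t) 2) (cong (suc t +_) (+-identityʳ (suc t)))) ⟩
  (suc t + suc t) % 2    ≡⟨ cong (_% 2) 1+n≡2[1+t] ⟨
  suc n % 2              ≡⟨ odd ⟩
  1                      ∎))
  where
  open ≡-Reasoning
  t = toℕ b
  n∸t≡1+t : n ∸ t ≡ suc t
  n∸t≡1+t = begin
    n ∸ t                       ≡⟨ m<n⇒m%n≡m (s≤s (m∸n≤m n t)) ⟨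
    (n ∸ t) % suc n             ≡⟨ toℕ-negF (Fin.suc b) ⟨
    toℕ (negF (Fin.suc b))      ≡⟨ cong toℕ fixed ⟩
    suc t                       ∎
  1+n≡2[1+t] : suc n ≡ suc t + suc t
  1+n≡2[1+t] = cong suc (trans (sym (m+[n∸m]≡n (<⇒≤ (toℕ<n b)))) (cong (t +_) n∸t≡1+t))

neg-fixed⇒0ᴱ : ∀ {qs} (odds : All Odd qs) → ∀ x → neg x ≡ x → x ≡ 0ᴱ (odd⇒positive odds)
neg-fixed⇒0ᴱ {[]}        []           tt      _     = refl
neg-fixed⇒0ᴱ {suc _ ∷ _} (odd ∷ odds) (a , x) fixed =
  cong₂ _,_ (negF-fixed⇒zero odd a (cong proj₁ fixed)) (neg-fixed⇒0ᴱ odds x (cong proj₂ fixed))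

proposition8p11 : (fs : List (ℕ × ℕ)) → All OddPrimePower fs →
    ((I : Subset (moduli fs)) → InI (moduli fs) I → (m : ℕ) → SpreadQuot (moduli fs) I m → HasType (moduli fs) I (typeTable m))
    × ((m : ℕ) → SpreadQuot (moduli fs) (λ _ → true) m → HasTypeG (moduli fs) (typeTable m))
    × ((m : ℕ) → Spread (moduli fs) m → Nim (moduli fs) [] (nimTable m))
proposition8p11 fs odd-powers = X-types , X-whole-type , nim-game
  where
  qs = moduli fs
  odds = odd-moduli fs odd-powers
  pos = odd⇒positive odds
  open OddOrder pos (neg-fixed⇒0ᴱ odds)

  X-types : (I : Subset qs) → InI qs I → (m : ℕ) → SpreadQuot qs I m → HasType qs I (typeTable m)
  X-types I I∈𝓘 m spr =
    X-type (Subgroups.InI⇒IsSubgroup pos I∈𝓘) (λ P → X-deficiency pos I∈𝓘 spr)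

  X-whole-type : (m : ℕ) → SpreadQuot qs (λ _ → true) m → HasTypeG qs (typeTable m)
  X-whole-type m spr = subst (HasTypeG qs ∘ typeTable) (sym (spread-of-whole spr))
    (trans (pty≡bit∘parity (order qs)) (cong bit order-odd) , refl , refl)

  nim-game : (m : ℕ) → Spread qs m → Nim qs [] (nimTable m)
  nim-game m spr = subst (Nim qs []) (sym (nimTable≡ m)) (nim-deficiency [] (spread-deficiency pos spr))
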